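{- Let $X$ be a finite connected directed graph and let $\alpha$ be a constant $\mathbb{Z}_p$-valued voltage assignment on $X$, with common value $\alpha\in\mathbb{Z}_p$, such that the graphs $X_n=X(\mathbb{Z}/p^n\mathbb{Z},\alpha_{/n})$, $n\ge0$, together with the natural projections, form a $\mathbb{Z}_p$-tower over $X$. Then $\alpha\in\mathbb{Z}_p^\times$.
   Context: Directed graphs may have multiple edges and loops; a directed graph is connected if its underlying undirected graph is connected. For an abelian group $G$ and a voltage assignment $\alpha:\mathbb{E}(X)\to G$, the derived graph $X(G,\alpha)$ has vertex set $\mathbb{V}(X)\times G$ and edge set $\mathbb{E}(X)\times G$, where if $e$ goes from $s$ to $t$ then $(e,\sigma)$ goes from $(s,\sigma)$ to $(t,\sigma+\alpha(e))$; it covers $X$ via $(x,\sigma)\mapsto x$. For $\alpha:\mathbb{E}(X)\to\mathbb{Z}_p$, $\alpha_{/n}$ is its composite with $\mathbb{Z}_p\to\mathbb{Z}/p^n\mathbb{Z}$; the natural projection $X_{n+1}\to X_n$ is $(x,a)\mapsto (x,a\bmod p^n)$. $\alpha$ is constant if it takes the same value on all edges. A covering $Y\to X$ is Galois if every vertex of $X$ has exactly $d$ preimages and the group of deck transformations (automorphisms $\sigma$ of $Y$ commuting with the projection) has order $d$. A $\mathbb{Z}_p$-tower over $X$ is a sequence of coverings $X=X_0\leftarrow X_1\leftarrow\cdots$ with each $X_n\to X$ Galois with deck group isomorphic to $\mathbb{Z}/p^n\mathbb{Z}$. -}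

module Defs where

open import Data.Nat using (ℕ; zero; suc; _+_; _*_; _^_; NonZero)
open import Data.Nat.DivMod using (_%_; m%n<n)
open import Data.Nat.Properties using (m^n≢0)
open import Data.Nat.Primality using (Prime; prime⇒nonZero)
open import Data.Fin using (Fin; toℕ; fromℕ<)
open import Data.Product using (Σ; _×_; _,_; proj₁; proj₂; ∃)
open import Relation.Binary.PropositionalEquality using (_≡_; refl; sym; cong; module ≡-Reasoning)
open import Data.Nat.DivMod using (%-distribˡ-+; m∣n⇒o%n%m≡o%m)
open import Data.Nat.Divisibility using (divides)
open import Data.Fin.Properties using (toℕ-fromℕ<; toℕ-injective)
open import Function.Bundles using (_↔_)

addMod : (m : ℕ) .{{_ : NonZero m}} → Fin m → Fin m → Fin m
addMod m a b = fromℕ< (m%n<n (toℕ a + toℕ b) m)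

pow-nz : ∀ {p} → Prime p → (n : ℕ) → NonZero (p ^ n)
pow-nz {p} pp n = m^n≢0 p n {{prime⇒nonZero pp}}

addZ : ∀ {p} → Prime p → (n : ℕ) → Fin (p ^ n) → Fin (p ^ n) → Fin (p ^ n)
addZ {p} pp n = addMod (p ^ n) {{pow-nz pp n}}

-- p-adic integers ℤ_p as compatible systems of residues a_n ∈ ℤ/p^nℤ

record ℤp (p : ℕ) (pp : Prime p) : Set where
  field
    res    : (n : ℕ) → Fin (p ^ n)
    compat : (n : ℕ) →
             _%_ (toℕ (res (suc n))) (p ^ n) {{pow-nz pp n}} ≡ toℕ (res n)
open ℤp public

mulRes : ∀ {p pp} → ℤp p pp → ℤp p pp → (n : ℕ) → ℕ
mulRes {p} {pp} a b n = _%_ (toℕ (res a n) * toℕ (res b n)) (p ^ n) {{pow-nz pp n}}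

IsUnitℤp : ∀ {p pp} → ℤp p pp → Set
IsUnitℤp {p} {pp} a =
  Σ (ℤp p pp) λ b → (n : ℕ) → mulRes a b n ≡ _%_ 1 (p ^ n) {{pow-nz pp n}}

record Graph : Set₁ where
  field
    V   : Set
    E   : Set
    src : E → V
    tgt : E → V
open Graph public

Finite : Graph → Set
Finite X = (Σ ℕ λ k → V X ↔ Fin k) × (Σ ℕ λ m → E X ↔ Fin m)

-- walks in the underlying undirected graph
data UPath (X : Graph) : V X → V X → Set where
  here : ∀ {u} → UPath X u u
  fwd  : ∀ {v} (e : E X) → UPath X (tgt X e) v → UPath X (src X e) v
  bwd  : ∀ {v} (e : E X) → UPath X (src X e) v → UPath X (tgt X e) v

Connected : Graph → Set
Connected X = (u v : V X) → UPath X u v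

record Hom (Y X : Graph) : Set where
  field
    onV   : V Y → V X
    onE   : E Y → E X
    onSrc : (e : E Y) → src X (onE e) ≡ onV (src Y e)
    onTgt : (e : E Y) → tgt X (onE e) ≡ onV (tgt Y e)
open Hom public

OutEdges InEdges : (X : Graph) → V X → Set
OutEdges X v = Σ (E X) λ e → src X e ≡ v
InEdges  X v = Σ (E X) λ e → tgt X e ≡ v

Fiber : ∀ {Y X} → Hom Y X → V X → Set
Fiber {Y} π x = Σ (V Y) λ y → onV π y ≡ x

record IsCovering {Y X : Graph} (π : Hom Y X) : Set where
  field
    surjV : (x : V X) → Fiber π x
    outBij : (y : V Y) → Σ (OutEdges Y y → OutEdges X (onV π y)) λ f →
               ((o : OutEdges Y y) → proj₁ (f o) ≡ onE π (proj₁ o))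
               × (∀ o o' → f o ≡ f o' → o ≡ o')
               × ((o : OutEdges X (onV π y)) → ∃ λ o' → f o' ≡ o)
    inBij  : (y : V Y) → Σ (InEdges Y y → InEdges X (onV π y)) λ f →
               ((o : InEdges Y y) → proj₁ (f o) ≡ onE π (proj₁ o))
               × (∀ o o' → f o ≡ f o' → o ≡ o')
               × ((o : InEdges X (onV π y)) → ∃ λ o' → f o' ≡ o)

record Deck {Y X : Graph} (π : Hom Y X) : Set where
  field
    σV    : V Y → V Y
    σE    : E Y → E Y
    σV⁻¹  : V Y → V Y
    σE⁻¹  : E Y → E Y
    invVˡ : ∀ y → σV⁻¹ (σV y) ≡ y
    invVʳ : ∀ y → σV (σV⁻¹ y) ≡ y
    invEˡ : ∀ e → σE⁻¹ (σE e) ≡ e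
    invEʳ : ∀ e → σE (σE⁻¹ e) ≡ e
    σsrc  : ∀ e → src Y (σE e) ≡ σV (src Y e)
    σtgt  : ∀ e → tgt Y (σE e) ≡ σV (tgt Y e)
    overV : ∀ y → onV π (σV y) ≡ onV π y
    overE : ∀ e → onE π (σE e) ≡ onE π e
open Deck public

_≈D_ : ∀ {Y X} {π : Hom Y X} → Deck π → Deck π → Set
σ ≈D τ = (∀ y → σV σ y ≡ σV τ y) × (∀ e → σE σ e ≡ σE τ e)

_∘D_ : ∀ {Y X} {π : Hom Y X} → Deck π → Deck π → Deck π
_∘D_ {Y} {X} {π} σ τ = record
  { σV = λ y → σV σ (σV τ y) ; σE = λ e → σE σ (σE τ e)
  ; σV⁻¹ = λ y → σV⁻¹ τ (σV⁻¹ σ y) ; σE⁻¹ = λ e → σE⁻¹ τ (σE⁻¹ σ e)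
  ; invVˡ = λ y → trans (cong (σV⁻¹ τ) (invVˡ σ (σV τ y))) (invVˡ τ y)
  ; invVʳ = λ y → trans (cong (σV σ) (invVʳ τ (σV⁻¹ σ y))) (invVʳ σ y)
  ; invEˡ = λ e → trans (cong (σE⁻¹ τ) (invEˡ σ (σE τ e))) (invEˡ τ e)
  ; invEʳ = λ e → trans (cong (σE σ) (invEʳ τ (σE⁻¹ σ e))) (invEʳ σ e)
  ; σsrc = λ e → trans (σsrc σ (σE τ e)) (cong (σV σ) (σsrc τ e))
  ; σtgt = λ e → trans (σtgt σ (σE τ e)) (cong (σV σ) (σtgt τ e))
  ; overV = λ y → trans (overV σ (σV τ y)) (overV τ y)
  ; overE = λ e → trans (overE σ (σE τ e)) (overE τ e) }
  where open import Relation.Binary.PropositionalEquality using (trans)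

DeckOrder : ∀ {Y X} → Hom Y X → ℕ → Set
DeckOrder π d = Σ (Fin d → Deck π) λ f →
  (∀ i j → f i ≈D f j → i ≡ j) × ((σ : Deck π) → ∃ λ i → f i ≈D σ)

record IsGalois {Y X : Graph} (π : Hom Y X) (d : ℕ) : Set where
  field
    covering : IsCovering π
    fibers   : (x : V X) → Fiber π x ↔ Fin d
    order    : DeckOrder π d

DeckIsoZ : ∀ {Y X} → Hom Y X → ∀ {p} → Prime p → ℕ → Set
DeckIsoZ π {p} pp n = Σ (Fin (p ^ n) → Deck π) λ φ →
  (∀ i j → φ i ≈D φ j → i ≡ j) × ((σ : Deck π) → ∃ λ i → φ i ≈D σ)
  × (∀ i j → φ (addZ pp n i j) ≈D (φ i ∘D φ j))

-- ℤ_p-tower: X = X_0 ← X_1 ← ..., each X_{n+1} → X_n a covering, each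
-- X_n → X Galois with deck group ≅ ℤ/p^nℤ (the maps X_n → X being the
-- composites of the projections, as required by compatibility)
record IsZpTower {p} (pp : Prime p) (X : Graph) (Xs : ℕ → Graph)
    (proj : (n : ℕ) → Hom (Xs (suc n)) (Xs n))
    (toBase : (n : ℕ) → Hom (Xs n) X) : Set where
  field
    projCov  : (n : ℕ) → IsCovering (proj n)
    compatV  : (n : ℕ) (y : V (Xs (suc n))) →
               onV (toBase n) (onV (proj n) y) ≡ onV (toBase (suc n)) y
    compatE  : (n : ℕ) (e : E (Xs (suc n))) →
               onE (toBase n) (onE (proj n) e) ≡ onE (toBase (suc n)) e
    galois   : (n : ℕ) → IsGalois (toBase n) (p ^ n)
    deckIso  : (n : ℕ) → DeckIsoZ (toBase n) pp n

module _ {p : ℕ} (pp : Prime p) (X : Graph) (α : E X → ℤp p pp) where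

  derived : ℕ → Graph
  derived n = record
    { V = V X × Fin (p ^ n)
    ; E = E X × Fin (p ^ n)
    ; src = λ { (e , σ) → src X e , σ }
    ; tgt = λ { (e , σ) → tgt X e , addZ pp n σ (res (α e) n) } }

  derivedToBase : (n : ℕ) → Hom (derived n) X
  derivedToBase n = record
    { onV = proj₁ ; onE = proj₁ ; onSrc = λ _ → refl ; onTgt = λ _ → refl }

  reduce : (n : ℕ) → Fin (p ^ suc n) → Fin (p ^ n)
  reduce n a = fromℕ< (m%n<n (toℕ a) (p ^ n) {{pow-nz pp n}})

  private
    reduce-add : (n : ℕ) (σ : Fin (p ^ suc n)) (e : E X) →
      addZ pp n (reduce n σ) (res (α e) n)
        ≡ reduce n (addZ pp (suc n) σ (res (α e) (suc n)))
    reduce-add n σ e = toℕ-injective (begin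
        toℕ (addZ pp n (reduce n σ) (res (α e) n))
          ≡⟨ toℕ-fromℕ< _ ⟩
        (toℕ (reduce n σ) + toℕ (res (α e) n)) % N
          ≡⟨ cong (λ t → (t + toℕ (res (α e) n)) % N) (toℕ-fromℕ< _) ⟩
        (a % N + toℕ (res (α e) n)) % N
          ≡⟨ cong (λ t → (a % N + t) % N) (sym (compat (α e) n)) ⟩
        (a % N + b % N) % N
          ≡⟨ sym (%-distribˡ-+ a b N) ⟩
        (a + b) % N
          ≡⟨ sym (m∣n⇒o%n%m≡o%m N M (a + b) {{nzN}} {{nzM}} (divides p refl)) ⟩
        (_%_ (a + b) M {{nzM}}) % N
          ≡⟨ cong (_% N) (sym (toℕ-fromℕ< _)) ⟩
        toℕ (addZ pp (suc n) σ (res (α e) (suc n))) % N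
          ≡⟨ sym (toℕ-fromℕ< _) ⟩
        toℕ (reduce n (addZ pp (suc n) σ (res (α e) (suc n)))) ∎)
      where
        open ≡-Reasoning
        N = p ^ n
        M = p ^ suc n
        nzN = pow-nz pp n
        nzM = pow-nz pp (suc n)
        instance _ = nzN
        a = toℕ σ
        b = toℕ (res (α e) (suc n))

  derivedProj : (n : ℕ) → Hom (derived (suc n)) (derived n)
  derivedProj n = record
    { onV = λ { (x , a) → x , reduce n a }
    ; onE = λ { (e , a) → e , reduce n a }
    ; onSrc = λ _ → refl
    ; onTgt = λ { (e , σ) → cong (tgt X e ,_) (reduce-add n σ e) } }

-- If p ∤ α_{/1}, every α_{/n} is prime to p, hence invertible modulo pⁿ by Bézout, and by
-- uniqueness of inverses these inverses form a compatible system, i.e. an element of ℤ_p.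
-- If p ∣ α_{/1}, then p ∣ α_{/2}, so each map a ↦ a + d (a mod p) of ℤ/p²ℤ commutes with the
-- translation by α_{/2}; when it is bijective it lifts to a deck transformation of X₂ → X.
-- Moving the class of 0 by p and swapping the classes of 0 and 1 give two such deck
-- transformations that do not commute at any vertex, whereas the deck group is ℤ/p²ℤ.
module Submission where

open import Data.Empty using (⊥; ⊥-elim)
open import Data.Fin using (Fin; zero; suc; toℕ; fromℕ<)
open import Data.Fin.Properties using (¬Fin0; toℕ-fromℕ<; toℕ<n; toℕ-injective)
open import Data.Nat
  using (ℕ; zero; suc; 2+; _+_; _*_; _∸_; _^_; _<_; _≤_; NonZero; ≢-nonZero; nonTrivial⇒n>1)
open import Data.Nat.Coprimality using (Coprime; coprime-Bézout; coprime-divisor; prime⇒coprime)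
open import Data.Nat.Divisibility
  using (_∣_; _∣?_; divides; ∣-trans; ∣1⇒≡1; %-presˡ-∣; m∣m*n; m%n≡0⇒n∣m; n∣m⇒m%n≡0)
open import Data.Nat.DivMod
open import Data.Nat.GCD using (module Bézout)
open import Data.Nat.Primality using (Prime; prime⇒nonZero; prime⇒nonTrivial; ¬prime[0]; ¬prime[1])
open import Data.Nat.Properties
open import Algebra.Properties.CommutativeSemigroup +-commutativeSemigroup using (xy∙z≈xz∙y)
open import Data.Nat.Solver using (module +-*-Solver)
open import Data.Product using (∃-syntax; _,_; proj₁; proj₂)
open import Function using (_∘_)
open import Function.Bundles using (Inverse; _↔_)
open import Relation.Binary.PropositionalEquality
open import Relation.Nullary using (¬_; yes; no)

open import Defs

open +-*-Solver using (solve; _:+_; _:*_; _:=_; con)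

module _ {d : ℕ} .{{_ : NonZero d}} where

  [m%d+n]%d≡[m+n]%d : ∀ m n → (m % d + n) % d ≡ (m + n) % d
  [m%d+n]%d≡[m+n]%d m n = begin
    (m % d + n) % d           ≡⟨ %-distribˡ-+ (m % d) n d ⟩
    (m % d % d + n % d) % d   ≡⟨ cong (λ t → (t + n % d) % d) (m%n%n≡m%n m d) ⟩
    (m % d + n % d) % d       ≡⟨ %-distribˡ-+ m n d ⟨
    (m + n) % d               ∎
    where open ≡-Reasoning

  [m+n%d]%d≡[m+n]%d : ∀ m n → (m + n % d) % d ≡ (m + n) % d
  [m+n%d]%d≡[m+n]%d m n = begin
    (m + n % d) % d   ≡⟨ cong (_% d) (+-comm m (n % d)) ⟩
    (n % d + m) % d   ≡⟨ [m%d+n]%d≡[m+n]%d n m ⟩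
    (n + m) % d       ≡⟨ cong (_% d) (+-comm n m) ⟩
    (m + n) % d       ∎
    where open ≡-Reasoning

  %-cong-*ˡ : ∀ o {m n} → m % d ≡ n % d → o * m % d ≡ o * n % d
  %-cong-*ˡ o {m} {n} m≡n = begin
    o * m % d                 ≡⟨ %-distribˡ-* o m d ⟩
    (o % d) * (m % d) % d     ≡⟨ cong (λ t → (o % d) * t % d) m≡n ⟩
    (o % d) * (n % d) % d     ≡⟨ %-distribˡ-* o n d ⟨
    o * n % d                 ∎
    where open ≡-Reasoning

  %-cong-*ʳ : ∀ o {m n} → m % d ≡ n % d → m * o % d ≡ n * o % d
  %-cong-*ʳ o {m} {n} m≡n = begin
    m * o % d   ≡⟨ cong (_% d) (*-comm m o) ⟩
    o * m % d   ≡⟨ %-cong-*ˡ o m≡n ⟩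
    o * n % d   ≡⟨ cong (_% d) (*-comm o n) ⟩
    n * o % d   ∎
    where open ≡-Reasoning

  %-inverse-unique : ∀ {a a′ b b′} → a * b % d ≡ 1 % d → a′ * b′ % d ≡ 1 % d →
                     a % d ≡ a′ % d → b % d ≡ b′ % d
  %-inverse-unique {a} {a′} {b} {b′} ab≡1 a′b′≡1 a≡a′ = begin
    b % d               ≡⟨ cong (_% d) (*-identityʳ b) ⟨
    b * 1 % d           ≡⟨ %-cong-*ˡ b a′b′≡1 ⟨
    b * (a′ * b′) % d   ≡⟨ %-cong-*ˡ b (%-cong-*ʳ b′ a≡a′) ⟨
    b * (a * b′) % d    ≡⟨ cong (_% d) (*-assoc b a b′) ⟨
    b * a * b′ % d      ≡⟨ cong (λ t → t * b′ % d) (*-comm b a) ⟩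
    a * b * b′ % d      ≡⟨ %-cong-*ʳ b′ ab≡1 ⟩
    1 * b′ % d          ≡⟨ cong (_% d) (*-identityˡ b′) ⟩
    b′ % d              ∎
    where open ≡-Reasoning

  %-cong-∣ : ∀ {c m n} .{{_ : NonZero c}} → d ∣ c → m % c ≡ n % c → m % d ≡ n % d
  %-cong-∣ {c} {m} {n} d∣c m≡n = begin
    m % d       ≡⟨ m∣n⇒o%n%m≡o%m d c m d∣c ⟨
    m % c % d   ≡⟨ cong (_% d) m≡n ⟩
    n % c % d   ≡⟨ m∣n⇒o%n%m≡o%m d c n d∣c ⟩
    n % d       ∎
    where open ≡-Reasoning

coprime⇒%-inverse : ∀ {a} d .{{_ : NonZero d}} → Coprime a d → ∃[ b ] a * b % d ≡ 1 % d
coprime⇒%-inverse {a} d a⊥d with coprime-Bézout a⊥d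
... | Bézout.+- x y 1+yd≡xa = x , (begin
  a * x % d       ≡⟨ cong (_% d) (trans (*-comm a x) (sym 1+yd≡xa)) ⟩
  (1 + y * d) % d ≡⟨ [m+kn]%n≡m%n 1 y d ⟩
  1 % d           ∎)
  where open ≡-Reasoning
coprime⇒%-inverse {a} d@(suc d-1) a⊥d | Bézout.-+ x y 1+xa≡yd = d-1 * x , (begin
  a * (d-1 * x) % d                 ≡⟨ [m+kn]%n≡m%n (a * (d-1 * x)) y d ⟨
  (a * (d-1 * x) + y * d) % d       ≡⟨ cong (λ t → (a * (d-1 * x) + t) % d) 1+xa≡yd ⟨
  (a * (d-1 * x) + (1 + x * a)) % d ≡⟨ cong (_% d) (solve 3 (λ m a x →
                                        a :* (m :* x) :+ (con 1 :+ x :* a) := con 1 :+ (a :* x) :* (con 1 :+ m))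
                                        refl d-1 a x) ⟩
  (1 + a * x * d) % d               ≡⟨ [m+kn]%n≡m%n 1 (a * x) d ⟩
  1 % d                             ∎)
  where open ≡-Reasoning

coprime-^ʳ : ∀ {m n} → Coprime m n → ∀ k → Coprime m (n ^ k)
coprime-^ʳ m⊥n zero    (_ , i∣1) = ∣1⇒≡1 i∣1
coprime-^ʳ m⊥n (suc k) (i∣m , i∣n*nᵏ) =
  coprime-^ʳ m⊥n k (i∣m , coprime-divisor (λ (j∣i , j∣n) → m⊥n (∣-trans j∣i i∣m , j∣n)) i∣n*nᵏ)

∤-prime⇒coprime : ∀ {p m} → Prime p → ¬ p ∣ m → Coprime m p
∤-prime⇒coprime {p} {m} pp p∤m (i∣m , i∣p) =
  prime⇒coprime pp {{≢-nonZero (p∤m ∘ m%n≡0⇒n∣m m p)}} (m%n<n m p) (i∣p , %-presˡ-∣ i∣m i∣p)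
  where instance _ = prime⇒nonZero pp

∣-resp-% : ∀ {d m n} .{{_ : NonZero d}} → m % d ≡ n % d → d ∣ m → d ∣ n
∣-resp-% {d} {m} {n} m≡n d∣m = m%n≡0⇒n∣m n d (trans (sym m≡n) (n∣m⇒m%n≡0 m d d∣m))

module _ {p : ℕ} {pp : Prime p} (α : ℤp p pp) where

  private
    infix 4 _≡_[mod-p^_]
    _≡_[mod-p^_] : ℕ → ℕ → ℕ → Set
    m ≡ n [mod-p^ k ] = _%_ m (p ^ k) {{pow-nz pp k}} ≡ _%_ n (p ^ k) {{pow-nz pp k}}

  res-≡-mod-pred : ∀ n → toℕ (res α (suc n)) ≡ toℕ (res α n) [mod-p^ n ]
  res-≡-mod-pred n = trans (compat α n) (sym (m<n⇒m%n≡m (toℕ<n (res α n))))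
    where instance _ = pow-nz pp n

  res-≡-mod : ∀ m k {d} .{{_ : NonZero d}} → d ∣ p ^ m →
              toℕ (res α (m + k)) % d ≡ toℕ (res α m) % d
  res-≡-mod m zero    d∣pᵐ rewrite +-identityʳ m = refl
  res-≡-mod m (suc k) d∣pᵐ rewrite +-suc m k =
    trans (%-cong-∣ (∣-trans d∣pᵐ pᵐ∣pᵐ⁺ᵏ) (res-≡-mod-pred (m + k))) (res-≡-mod m k d∣pᵐ)
    where
    pᵐ∣pᵐ⁺ᵏ : p ^ m ∣ p ^ (m + k)
    pᵐ∣pᵐ⁺ᵏ = subst (p ^ m ∣_) (sym (^-distribˡ-+-* p m k)) (m∣m*n (p ^ k))
    instance _ = pow-nz pp (m + k)

  p∣res₁⇒p∣res₂ : p ∣ toℕ (res α 1) → p ∣ toℕ (res α 2)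
  p∣res₁⇒p∣res₂ = ∣-resp-% (sym (res-≡-mod 1 1 (m∣m*n 1)))
    where instance _ = prime⇒nonZero pp

  ¬p∣res₁⇒unit : ¬ p ∣ toℕ (res α 1) → IsUnitℤp α
  ¬p∣res₁⇒unit p∤a₁ = β , αβ≡1
    where
    instance _ = prime⇒nonZero pp
    a : ℕ → ℕ
    a n = toℕ (res α n)

    a⊥pⁿ : ∀ n → Coprime (a n) (p ^ n)
    a⊥pⁿ zero    (_ , i∣1) = ∣1⇒≡1 i∣1
    a⊥pⁿ (suc n) = coprime-^ʳ (∤-prime⇒coprime pp p∤aₙ₊₁) (suc n)
      where
      p∤aₙ₊₁ : ¬ p ∣ a (suc n)
      p∤aₙ₊₁ = p∤a₁ ∘ ∣-resp-% (res-≡-mod 1 n (m∣m*n 1))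

    inverse : ∀ n → ∃[ b ] a n * b ≡ 1 [mod-p^ n ]
    inverse n = coprime⇒%-inverse (p ^ n) {{pow-nz pp n}} (a⊥pⁿ n)

    b : ℕ → ℕ
    b n = proj₁ (inverse n)

    bₙ₊₁≡bₙ : ∀ n → b (suc n) ≡ b n [mod-p^ n ]
    bₙ₊₁≡bₙ n = %-inverse-unique {d = p ^ n} (%-cong-∣ (divides p refl) (proj₂ (inverse (suc n))))
                                             (proj₂ (inverse n)) (res-≡-mod-pred n)
      where instance _ = pow-nz pp n
                     _ = pow-nz pp (suc n)

    β : ℤp p pp
    β = record
      { res    = λ n → fromℕ< (m%n<n (b n) (p ^ n) {{pow-nz pp n}})
      ; compat = λ n → let instance _ = pow-nz pp n; _ = pow-nz pp (suc n) in begin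
          toℕ (fromℕ< (m%n<n (b (suc n)) (p ^ suc n))) % p ^ n
            ≡⟨ cong (_% p ^ n) (toℕ-fromℕ< _) ⟩
          b (suc n) % p ^ suc n % p ^ n
            ≡⟨ m∣n⇒o%n%m≡o%m (p ^ n) (p ^ suc n) (b (suc n)) (divides p refl) ⟩
          b (suc n) % p ^ n
            ≡⟨ bₙ₊₁≡bₙ n ⟩
          b n % p ^ n
            ≡⟨ toℕ-fromℕ< _ ⟨
          toℕ (fromℕ< (m%n<n (b n) (p ^ n)))
            ∎
      }
      where open ≡-Reasoning

    αβ≡1 : ∀ n → a n * toℕ (res β n) ≡ 1 [mod-p^ n ]
    αβ≡1 n = trans (%-cong-*ˡ (a n) β≡b) (proj₂ (inverse n))
      where
      instance _ = pow-nz pp n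
      β≡b : toℕ (res β n) % p ^ n ≡ b n % p ^ n
      β≡b = trans (cong (_% p ^ n) (toℕ-fromℕ< _)) (m%n%n≡m%n (b n) (p ^ n))

addMod-comm : ∀ m .{{_ : NonZero m}} (a b : Fin m) → addMod m a b ≡ addMod m b a
addMod-comm m a b = toℕ-injective (begin
  toℕ (addMod m a b)    ≡⟨ toℕ-fromℕ< _ ⟩
  (toℕ a + toℕ b) % m   ≡⟨ cong (_% m) (+-comm (toℕ a) (toℕ b)) ⟩
  (toℕ b + toℕ a) % m   ≡⟨ toℕ-fromℕ< _ ⟨
  toℕ (addMod m b a)    ∎)
  where open ≡-Reasoning

DeckCommutative : ∀ {Y X} → Hom Y X → Set
DeckCommutative π = (σ τ : Deck π) → ∀ y → σV σ (σV τ y) ≡ σV τ (σV σ y)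

module _ {Y X : Graph} {π : Hom Y X} where

  DeckIsoZ⇒DeckCommutative : ∀ {p} {pp : Prime p} {n} → DeckIsoZ π pp n → DeckCommutative π
  DeckIsoZ⇒DeckCommutative {p} {pp} {n} (φ , _ , onto , hom) σ τ y with onto σ | onto τ
  ... | i , φi≈σ | j , φj≈τ = begin
    σV σ (σV τ y)             ≡⟨ proj₁ φi≈σ _ ⟨
    σV (φ i) (σV τ y)         ≡⟨ cong (σV (φ i)) (proj₁ φj≈τ y) ⟨
    σV (φ i) (σV (φ j) y)     ≡⟨ proj₁ (hom i j) y ⟨
    σV (φ (addZ pp n i j)) y  ≡⟨ cong (λ k → σV (φ k) y) (addMod-comm (p ^ n) {{pow-nz pp n}} i j) ⟩
    σV (φ (addZ pp n j i)) y  ≡⟨ proj₁ (hom j i) y ⟩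
    σV (φ j) (σV (φ i) y)     ≡⟨ proj₁ φj≈τ _ ⟩
    σV τ (σV (φ i) y)         ≡⟨ cong (σV τ) (proj₁ φi≈σ y) ⟩
    σV τ (σV σ y)             ∎
    where open ≡-Reasoning

  vertexless⇒≈D : (V Y → ⊥) → (σ τ : Deck π) → σ ≈D τ
  vertexless⇒≈D noV σ τ = (λ y → ⊥-elim (noV y)) , (λ e → ⊥-elim (noV (src Y e)))

  vertexless⇒¬DeckIsoZ : ∀ {p} {pp : Prime p} → (V Y → ⊥) → ¬ DeckIsoZ π pp 1
  vertexless⇒¬DeckIsoZ {0}     {pp} _ _ = ¬prime[0] pp
  vertexless⇒¬DeckIsoZ {1}     {pp} _ _ = ¬prime[1] pp
  vertexless⇒¬DeckIsoZ {2+ _}  noV (φ , φ-injective , _)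
    with φ-injective zero (suc zero) (vertexless⇒≈D noV (φ zero) (φ (suc zero)))
  ... | ()

module _ {p} (pp : Prime p) (X : Graph) (α : ℤp p pp) (n : ℕ) where

  fibreDeck : (f f⁻¹ : Fin (p ^ n) → Fin (p ^ n)) →
              (∀ a → f⁻¹ (f a) ≡ a) → (∀ a → f (f⁻¹ a) ≡ a) →
              (∀ a → f (addZ pp n a (res α n)) ≡ addZ pp n (f a) (res α n)) →
              Deck (derivedToBase pp X (λ _ → α) n)
  fibreDeck f f⁻¹ f⁻¹∘f f∘f⁻¹ f-translate = record
    { σV    = λ (x , a) → x , f a
    ; σE    = λ (e , a) → e , f a
    ; σV⁻¹  = λ (x , a) → x , f⁻¹ a
    ; σE⁻¹  = λ (e , a) → e , f⁻¹ a
    ; invVˡ = λ (x , a) → cong (x ,_) (f⁻¹∘f a)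
    ; invVʳ = λ (x , a) → cong (x ,_) (f∘f⁻¹ a)
    ; invEˡ = λ (e , a) → cong (e ,_) (f⁻¹∘f a)
    ; invEʳ = λ (e , a) → cong (e ,_) (f∘f⁻¹ a)
    ; σsrc  = λ _ → refl
    ; σtgt  = λ (e , a) → cong (tgt X e ,_) (sym (f-translate a))
    ; overV = λ _ → refl
    ; overE = λ _ → refl
    }

1<m⇒1+m<m^2 : ∀ {m} → 1 < m → suc m < m ^ 2
1<m⇒1+m<m^2 {m} 1<m = begin-strict
  1 + m       <⟨ +-monoˡ-< m 1<m ⟩
  m + m       ≡⟨ cong (m +_) (*-identityʳ m) ⟨
  m + m * 1   ≡⟨ *-suc m 1 ⟨
  m * 2       ≤⟨ *-monoʳ-≤ m 1<m ⟩
  m * m       ≡⟨ cong (m *_) (*-identityʳ m) ⟨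
  m ^ 2       ∎
  where open ≤-Reasoning

module ResidueShift (N P : ℕ) .{{_ : NonZero N}} .{{_ : NonZero P}} (P∣N : P ∣ N) where

  shift : (ℕ → ℕ) → Fin N → Fin N
  shift d a = fromℕ< (m%n<n (toℕ a + d (toℕ a % P)) N)

  toℕ-shift : ∀ d a {x r} → toℕ a ≡ x → x % P ≡ r → x + d r < N → toℕ (shift d a) ≡ x + d r
  toℕ-shift d a refl refl x+dr<N = trans (toℕ-fromℕ< _) (m<n⇒m%n≡m x+dr<N)

  shift-translate : ∀ d (a c : Fin N) → P ∣ toℕ c → shift d (addMod N a c) ≡ addMod N (shift d a) c
  shift-translate d a c P∣c = toℕ-injective (begin
    toℕ (shift d (addMod N a c))                  ≡⟨ toℕ-fromℕ< _ ⟩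
    (A+C + d (A+C % P)) % N                       ≡⟨ cong (λ t → (A+C + d t) % N) same-class ⟩
    (A+C + D) % N                                 ≡⟨ cong (λ t → (t + D) % N) (toℕ-fromℕ< _) ⟩
    ((A + C) % N + D) % N                         ≡⟨ [m%d+n]%d≡[m+n]%d (A + C) D ⟩
    (A + C + D) % N                               ≡⟨ cong (_% N) (xy∙z≈xz∙y A C D) ⟩
    (A + D + C) % N                               ≡⟨ [m%d+n]%d≡[m+n]%d (A + D) C ⟨
    ((A + D) % N + C) % N                         ≡⟨ cong (λ t → (t + C) % N) (toℕ-fromℕ< _) ⟨
    (toℕ (shift d a) + C) % N                     ≡⟨ toℕ-fromℕ< _ ⟨
    toℕ (addMod N (shift d a) c)                  ∎)
    where
    open ≡-Reasoning
    A C D A+C : ℕ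
    A = toℕ a
    C = toℕ c
    D = d (A % P)
    A+C = toℕ (addMod N a c)
    same-class : A+C % P ≡ A % P
    same-class = trans (cong (_% P) (toℕ-fromℕ< _))
                       (trans (m∣n⇒o%n%m≡o%m P N (A + C) P∣N) (%-remove-+ʳ A P∣c))

  _Undoes_ : (ℕ → ℕ) → (ℕ → ℕ) → Set
  d′ Undoes d = ∀ r → r < P → (d r + d′ ((r + d r) % P)) % N ≡ 0

  shift-undo : ∀ d d′ → d′ Undoes d → ∀ a → shift d′ (shift d a) ≡ a
  shift-undo d d′ undo a = toℕ-injective (begin
    toℕ (shift d′ (shift d a))                    ≡⟨ toℕ-fromℕ< _ ⟩
    (B + d′ (B % P)) % N                          ≡⟨ cong (λ t → (B + d′ t) % N) same-class ⟩
    (B + d′ s) % N                                ≡⟨ cong (λ t → (t + d′ s) % N) (toℕ-fromℕ< _) ⟩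
    ((A + d r) % N + d′ s) % N                    ≡⟨ [m%d+n]%d≡[m+n]%d (A + d r) (d′ s) ⟩
    (A + d r + d′ s) % N                          ≡⟨ cong (_% N) (+-assoc A (d r) (d′ s)) ⟩
    (A + (d r + d′ s)) % N                        ≡⟨ [m+n%d]%d≡[m+n]%d A (d r + d′ s) ⟨
    (A + (d r + d′ s) % N) % N                    ≡⟨ cong (λ t → (A + t) % N) (undo r (m%n<n A P)) ⟩
    (A + 0) % N                                   ≡⟨ cong (_% N) (+-identityʳ A) ⟩
    A % N                                         ≡⟨ m<n⇒m%n≡m (toℕ<n a) ⟩
    A                                             ∎)
    where
    open ≡-Reasoning
    A r s B : ℕ
    A = toℕ a
    r = A % P
    s = (r + d r) % P
    B = toℕ (shift d a)
    same-class : B % P ≡ s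
    same-class = begin
      B % P                 ≡⟨ cong (_% P) (toℕ-fromℕ< _) ⟩
      (A + d r) % N % P     ≡⟨ m∣n⇒o%n%m≡o%m P N (A + d r) P∣N ⟩
      (A + d r) % P         ≡⟨ [m%d+n]%d≡[m+n]%d A (d r) ⟨
      s                     ∎

  module Noncommuting (1<P : 1 < P) (1+P<N : suc P < N) where

    P≤N : P ≤ N
    P≤N = ≤-trans (n≤1+n P) (<⇒≤ 1+P<N)

    1<N : 1 < N
    1<N = ≤-trans 1<P (<⇒≤ (≤-trans (n≤1+n (suc P)) 1+P<N))

    0%P≡0 : 0 % P ≡ 0
    0%P≡0 = m*n%n≡0 0 P

    0%N≡0 : 0 % N ≡ 0
    0%N≡0 = m*n%n≡0 0 N

    1+[N∸1]≡N : 1 + (N ∸ 1) ≡ N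
    1+[N∸1]≡N = m+[n∸m]≡n (<⇒≤ 1<N)

    N%P≡0 : N % P ≡ 0
    N%P≡0 = n∣m⇒m%n≡0 N P P∣N

    [r+0]%P≡r : ∀ {r} → r < P → (r + 0) % P ≡ r
    [r+0]%P≡r {r} r<P = trans (cong (_% P) (+-identityʳ r)) (m<n⇒m%n≡m r<P)

    d₁ d₁⁻¹ d₂ : ℕ → ℕ
    d₁ 0         = P
    d₁ (suc _)   = 0
    d₁⁻¹ 0       = N ∸ P
    d₁⁻¹ (suc _) = 0
    d₂ 0         = 1
    d₂ 1         = N ∸ 1
    d₂ (2+ _)    = 0

    d₁⁻¹-undoes-d₁ : d₁⁻¹ Undoes d₁
    d₁⁻¹-undoes-d₁ 0       _ = begin
      (P + d₁⁻¹ (P % P)) % N  ≡⟨ cong (λ t → (P + d₁⁻¹ t) % N) (n%n≡0 P) ⟩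
      (P + (N ∸ P)) % N       ≡⟨ cong (_% N) (m+[n∸m]≡n P≤N) ⟩
      N % N                   ≡⟨ n%n≡0 N ⟩
      0                       ∎
      where open ≡-Reasoning
    d₁⁻¹-undoes-d₁ (suc k) k<P = trans (cong (λ t → d₁⁻¹ t % N) ([r+0]%P≡r k<P)) 0%N≡0

    d₁-undoes-d₁⁻¹ : d₁ Undoes d₁⁻¹
    d₁-undoes-d₁⁻¹ 0       _ = begin
      (N ∸ P + d₁ ((N ∸ P) % P)) % N  ≡⟨ cong (λ t → (N ∸ P + d₁ t) % N) [N∸P]%P≡0 ⟩
      (N ∸ P + P) % N                 ≡⟨ cong (_% N) (m∸n+n≡m P≤N) ⟩
      N % N                           ≡⟨ n%n≡0 N ⟩
      0                               ∎
      where
      open ≡-Reasoning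
      [N∸P]%P≡0 : (N ∸ P) % P ≡ 0
      [N∸P]%P≡0 = trans (m≤n⇒[n∸m]%m≡n%m P≤N) N%P≡0
    d₁-undoes-d₁⁻¹ (suc k) k<P = trans (cong (λ t → d₁ t % N) ([r+0]%P≡r k<P)) 0%N≡0

    d₂-undoes-d₂ : d₂ Undoes d₂
    d₂-undoes-d₂ 0 _ = begin
      (1 + d₂ (1 % P)) % N    ≡⟨ cong (λ t → (1 + d₂ t) % N) (m<n⇒m%n≡m 1<P) ⟩
      (1 + (N ∸ 1)) % N       ≡⟨ cong (_% N) 1+[N∸1]≡N ⟩
      N % N                   ≡⟨ n%n≡0 N ⟩
      0                       ∎
      where open ≡-Reasoning
    d₂-undoes-d₂ 1 _ = begin
      (N ∸ 1 + d₂ ((1 + (N ∸ 1)) % P)) % N  ≡⟨ cong (λ t → (N ∸ 1 + d₂ (t % P)) % N) 1+[N∸1]≡N ⟩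
      (N ∸ 1 + d₂ (N % P)) % N              ≡⟨ cong (λ t → (N ∸ 1 + d₂ t) % N) N%P≡0 ⟩
      (N ∸ 1 + 1) % N                       ≡⟨ cong (_% N) (m∸n+n≡m (<⇒≤ 1<N)) ⟩
      N % N                                 ≡⟨ n%n≡0 N ⟩
      0                                     ∎
      where open ≡-Reasoning
    d₂-undoes-d₂ (2+ k) k<P = trans (cong (λ t → d₂ t % N) ([r+0]%P≡r k<P)) 0%N≡0

    shift-d₁-d₂-noncommuting : ∃[ a ] shift d₁ (shift d₂ a) ≢ shift d₂ (shift d₁ a)
    shift-d₁-d₂-noncommuting = a₀ , λ eq →
      1≢1+P (trans (sym 1≡d₁d₂a₀) (trans (cong toℕ eq) d₂d₁a₀≡1+P))
      where
      a₀ : Fin N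
      a₀ = fromℕ< (≤-trans (n≤1+n 1) 1<N)
      toℕ-a₀ : toℕ a₀ ≡ 0
      toℕ-a₀ = toℕ-fromℕ< _
      1≡d₁d₂a₀ : toℕ (shift d₁ (shift d₂ a₀)) ≡ 1
      1≡d₁d₂a₀ = toℕ-shift d₁ _ (toℕ-shift d₂ a₀ toℕ-a₀ 0%P≡0 1<N) (m<n⇒m%n≡m 1<P) 1<N
      d₂d₁a₀≡1+P : toℕ (shift d₂ (shift d₁ a₀)) ≡ P + 1
      d₂d₁a₀≡1+P = toℕ-shift d₂ _ (toℕ-shift d₁ a₀ toℕ-a₀ 0%P≡0 (≤-trans (n≤1+n (suc P)) 1+P<N))
                     (n%n≡0 P) (subst (_< N) (+-comm 1 P) 1+P<N)
      1≢1+P : 1 ≢ P + 1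
      1≢1+P eq = <⇒≢ (≤-trans (n≤1+n 1) 1<P) (suc-injective (trans eq (+-comm P 1)))

module _ {p} (pp : Prime p) (X : Graph) (α : ℤp p pp) where

  p∣res₂⇒¬DeckCommutative : p ∣ toℕ (res α 2) → V X →
                            ¬ DeckCommutative (derivedToBase pp X (λ _ → α) 2)
  p∣res₂⇒¬DeckCommutative p∣α₂ x commute = noncommuting (cong proj₂ (commute σ₁ σ₂ (x , a)))
    where
    instance _ = prime⇒nonZero pp
             _ = pow-nz pp 2
    open ResidueShift (p ^ 2) p (m∣m*n (p ^ 1))
    1<p : 1 < p
    1<p = nonTrivial⇒n>1 p {{prime⇒nonTrivial pp}}
    open Noncommuting 1<p (1<m⇒1+m<m^2 1<p)

    shiftDeck : ∀ d d⁻¹ → d⁻¹ Undoes d → d Undoes d⁻¹ → Deck (derivedToBase pp X (λ _ → α) 2)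
    shiftDeck d d⁻¹ d⁻¹∘d d∘d⁻¹ =
      fibreDeck pp X α 2 (shift d) (shift d⁻¹) (shift-undo d d⁻¹ d⁻¹∘d) (shift-undo d⁻¹ d d∘d⁻¹)
                (λ a → shift-translate d a (res α 2) p∣α₂)

    σ₁ σ₂ : Deck (derivedToBase pp X (λ _ → α) 2)
    σ₁ = shiftDeck d₁ d₁⁻¹ d₁⁻¹-undoes-d₁ d₁-undoes-d₁⁻¹
    σ₂ = shiftDeck d₂ d₂ d₂-undoes-d₂ d₂-undoes-d₂

    a : Fin (p ^ 2)
    a = proj₁ shift-d₁-d₂-noncommuting
    noncommuting : shift d₁ (shift d₂ a) ≢ shift d₂ (shift d₁ a)
    noncommuting = proj₂ shift-d₁-d₂-noncommuting

lemma3p3 : (p : ℕ) (pp : Prime p) (X : Graph) → Finite X → Connected X →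
           (α : ℤp p pp) →
           IsZpTower pp X (derived pp X (λ _ → α)) (derivedProj pp X (λ _ → α))
             (derivedToBase pp X (λ _ → α)) →
           IsUnitℤp α
lemma3p3 p pp X ((k , V↔Fin) , _) _ α tower with p ∣? toℕ (res α 1)
... | no  p∤α₁ = ¬p∣res₁⇒unit α p∤α₁
... | yes p∣α₁ = ⊥-elim (no-tower k V↔Fin)
  where
  open IsZpTower tower using (deckIso)
  no-tower : ∀ k → V X ↔ Fin k → ⊥
  no-tower zero    V↔Fin₀ = vertexless⇒¬DeckIsoZ {pp = pp}
                              (λ (x , _) → ¬Fin0 (Inverse.to V↔Fin₀ x)) (deckIso 1)
  no-tower (suc _) V↔Fin  = p∣res₂⇒¬DeckCommutative pp X α (p∣res₁⇒p∣res₂ α p∣α₁)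
                              (Inverse.from V↔Fin zero)
                              (DeckIsoZ⇒DeckCommutative {pp = pp} {n = 2} (deckIso 2))
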